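{- For the single-machine scheduling problem with uniform linear deterioration and release times, any $\rho$-approximation algorithm for minimizing the makespan is $\left(1+\frac{1}{\beta}\right)\rho$-approximate for minimizing the sum of completion times $\sum_{i\in\mathcal{J}}C_i$.
   Context: Problem: a single machine must process a set $\mathcal{J}=\{1,\ldots,n\}$ of jobs non-preemptively, at most one job at a time. Job $i$ has a release time $r_i\ge 0$ and a fixed processing time $\alpha_i\ge 0$, and there is a common deterioration rate $\beta>0$. If job $i$ starts at time $s_i\ge r_i$, its processing time is $p_i(s_i)=\alpha_i+\beta s_i$, so it completes at $C_i=(1+\beta)s_i+\alpha_i$. A schedule is feasible if jobs do not overlap and $s_i\ge r_i$ for all $i$. The makespan is $\max_i C_i$ and the total completion time is $\sum_i C_i$. An algorithm is $\rho$-approximate for an objective if on every instance it returns a feasible schedule whose objective value is at most $\rho$ times the optimal objective value.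
   Formalization: The release times, fixed processing times, deterioration rate β, ratio ρ and all start times of schedules are rational. -}

module Defs where

open import Data.Nat using (ℕ; zero; suc)
open import Data.Fin using (Fin; zero; suc)
open import Data.Rational using (ℚ; 0ℚ; 1ℚ; _+_; _*_; _≤_; _⊔_)
open import Data.Product using (_×_)
open import Data.Sum using (_⊎_)
open import Relation.Binary.PropositionalEquality using (_≢_)

-- An instance with n jobs: release times r and fixed processing times α.
-- A schedule assigns a start time s i to every job i.

completion : (β : ℚ) {n : ℕ} (α s : Fin n → ℚ) → Fin n → ℚ
completion β α s i = (1ℚ + β) * s i + α i

Feasible : (β : ℚ) {n : ℕ} (r α s : Fin n → ℚ) → Set
Feasible β {n} r α s =
  ((i : Fin n) → r i ≤ s i) ×
  ((i j : Fin n) → i ≢ j →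
     completion β α s i ≤ s j ⊎ completion β α s j ≤ s i)

-- maximum of a finite family (0 for the empty family; all values here are ≥ 0)
maxFin : {n : ℕ} → (Fin n → ℚ) → ℚ
maxFin {zero} f = 0ℚ
maxFin {suc n} f = f zero ⊔ maxFin (λ i → f (suc i))

sumFin : {n : ℕ} → (Fin n → ℚ) → ℚ
sumFin {zero} f = 0ℚ
sumFin {suc n} f = f zero + sumFin (λ i → f (suc i))

Objective : Set
Objective = (β : ℚ) {n : ℕ} (α s : Fin n → ℚ) → ℚ

makespan : Objective
makespan β α s = maxFin (completion β α s)

totalCompletion : Objective
totalCompletion β α s = sumFin (completion β α s)

-- An algorithm (for fixed deterioration rate β) maps an instance (n, r, α)
-- to a schedule.
Algorithm : Set
Algorithm = (n : ℕ) (r α : Fin n → ℚ) → Fin n → ℚ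

ApproxFor : Objective → (β ρ : ℚ) → Algorithm → Set
ApproxFor f β ρ A =
  (n : ℕ) (r α : Fin n → ℚ) →
  ((i : Fin n) → 0ℚ ≤ r i) → ((i : Fin n) → 0ℚ ≤ α i) →
  Feasible β r α (A n r α) ×
  ((s : Fin n → ℚ) → Feasible β r α s →
     f β α (A n r α) ≤ ρ * f β α s)

{-# OPTIONS --safe #-}
-- Write p_i = β s_i + α_i for the actual processing time of job i, so that C_i = s_i + p_i.
-- In a feasible schedule the busy intervals [s_i, C_i] are disjoint and lie in
-- [0, C_max], hence Σ p_i ≤ C_max; and β s_i ≤ p_i gives C_i ≤ (1 + 1/β) p_i.
-- Therefore Σ C_i ≤ (1 + 1/β) C_max for every feasible schedule. Applied to the
-- schedule of the algorithm, and combined with C_max ≤ Σ C_i for the compared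
-- schedule, this turns a ρ-approximation for C_max into a (1 + 1/β) ρ-approximation
-- for Σ C_i.
module Submission where

open import Defs
open import Data.Rational using (ℚ; 0ℚ; 1ℚ; _+_; _*_; _<_; 1/_; >-nonZero)
open import Data.Rational.Base using (_≤_; positive; nonNegative)
open import Data.Rational.Properties
open import Data.Rational.Solver using (module +-*-Solver)
open import Algebra.Bundles using (Ring)
open import Algebra.Properties.Semiring.Sum (Ring.semiring +-*-ring)
  using (sum; sum-remove; *-distribˡ-sum)
open import Data.Nat using (ℕ; zero; suc)
open import Data.Fin using (Fin; zero; suc; punchIn)
open import Data.Fin.Properties using (punchIn-injective; punchInᵢ≢i)
open import Data.Vec.Functional using (removeAt)
open import Data.Product using (Σ; _,_; proj₁; proj₂)
open import Data.Sum using (_⊎_; inj₁; inj₂)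
open import Data.Empty using (⊥-elim)
import Data.Sum as Sum
open import Function using (_∘_)
open import Relation.Nullary using (Dec; yes; no)
open import Relation.Binary.PropositionalEquality
  using (_≡_; _≢_; refl; cong; subst)

open +-*-Solver using (solve; _:+_; _:*_; _:=_; con)
open ≤-Reasoning

p≤p+q : ∀ p {q} → 0ℚ ≤ q → p ≤ p + q
p≤p+q p {q} 0≤q = begin
  p       ≡⟨ +-identityʳ p ⟨
  p + 0ℚ  ≤⟨ +-monoʳ-≤ p 0≤q ⟩
  p + q   ∎

q≤p+q : ∀ {p} q → 0ℚ ≤ p → q ≤ p + q
q≤p+q {p} q 0≤p = begin
  q       ≡⟨ +-identityˡ q ⟨
  0ℚ + q  ≤⟨ +-monoˡ-≤ q 0≤p ⟩
  p + q   ∎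

sumFin≡sum : {n : ℕ} (f : Fin n → ℚ) → sumFin f ≡ sum f
sumFin≡sum {zero}  f = refl
sumFin≡sum {suc n} f = cong (f zero +_) (sumFin≡sum (f ∘ suc))

sumFin-removeAt : {n : ℕ} (f : Fin (suc n) → ℚ) (k : Fin (suc n)) →
  sumFin f ≡ f k + sumFin (removeAt f k)
sumFin-removeAt f k = begin-equality
  sumFin f                    ≡⟨ sumFin≡sum f ⟩
  sum f                       ≡⟨ sum-remove f ⟩
  f k + sum (removeAt f k)    ≡⟨ cong (f k +_) (sumFin≡sum (removeAt f k)) ⟨
  f k + sumFin (removeAt f k) ∎

*-distribˡ-sumFin : {n : ℕ} (c : ℚ) (f : Fin n → ℚ) →
  c * sumFin f ≡ sumFin (λ i → c * f i)
*-distribˡ-sumFin c f = begin-equality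
  c * sumFin f              ≡⟨ cong (c *_) (sumFin≡sum f) ⟩
  c * sum f                 ≡⟨ *-distribˡ-sum c f ⟩
  sum (λ i → c * f i)       ≡⟨ sumFin≡sum (λ i → c * f i) ⟨
  sumFin (λ i → c * f i)    ∎

sumFin-mono-≤ : {n : ℕ} {f g : Fin n → ℚ} → (∀ i → f i ≤ g i) → sumFin f ≤ sumFin g
sumFin-mono-≤ {zero}  f≤g = ≤-refl
sumFin-mono-≤ {suc n} f≤g = +-mono-≤ (f≤g zero) (sumFin-mono-≤ (f≤g ∘ suc))

sumFin-nonNeg : {n : ℕ} {f : Fin n → ℚ} → (∀ i → 0ℚ ≤ f i) → 0ℚ ≤ sumFin f
sumFin-nonNeg {zero}  0≤f = ≤-refl
sumFin-nonNeg {suc n} 0≤f = +-mono-≤ (0≤f zero) (sumFin-nonNeg (0≤f ∘ suc))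

f≤maxFin : {n : ℕ} (f : Fin n → ℚ) (i : Fin n) → f i ≤ maxFin f
f≤maxFin f zero    = p≤p⊔q (f zero) _
f≤maxFin f (suc i) = p≤q⇒p≤r⊔q (f zero) (f≤maxFin (f ∘ suc) i)

-- maxFin of the empty family is 0, so the bound needs no hypothesis on f.
maxFin-nonNeg : {n : ℕ} (f : Fin n → ℚ) → 0ℚ ≤ maxFin f
maxFin-nonNeg {zero}  f = ≤-refl
maxFin-nonNeg {suc n} f = p≤q⇒p≤r⊔q (f zero) (maxFin-nonNeg (f ∘ suc))

maxFin≤sumFin : {n : ℕ} {f : Fin n → ℚ} → (∀ i → 0ℚ ≤ f i) → maxFin f ≤ sumFin f
maxFin≤sumFin {zero}  0≤f = ≤-refl
maxFin≤sumFin {suc n} {f} 0≤f = ⊔-lub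
  (p≤p+q (f zero) (sumFin-nonNeg (0≤f ∘ suc)))
  (≤-trans (maxFin≤sumFin (0≤f ∘ suc)) (q≤p+q _ (0≤f zero)))

argmax : {n : ℕ} (f : Fin (suc n) → ℚ) → Σ (Fin (suc n)) λ k → ∀ i → f i ≤ f k
argmax {zero}  f = zero , λ { zero → ≤-refl }
argmax {suc n} f with argmax (f ∘ suc)
... | k , f∘suc≤fk with f zero ≤? f (suc k)
...   | yes f0≤fk = suc k , λ { zero → f0≤fk ; (suc i) → f∘suc≤fk i }
...   | no  f0≰fk =
  zero , λ { zero → ≤-refl ; (suc i) → ≤-trans (f∘suc≤fk i) (<⇒≤ (≰⇒> f0≰fk)) }

NonOverlapping : {n : ℕ} (s l : Fin n → ℚ) → Set
NonOverlapping {n} s l = (i j : Fin n) → i ≢ j → s i + l i ≤ s j ⊎ s j + l j ≤ s i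

nonOverlapping-removeAt : {n : ℕ} {s l : Fin (suc n) → ℚ} → NonOverlapping s l →
  (k : Fin (suc n)) → NonOverlapping (removeAt s k) (removeAt l k)
nonOverlapping-removeAt disjoint k i j i≢j =
  disjoint (punchIn k i) (punchIn k j) (i≢j ∘ punchIn-injective k i j)

-- Induction on the job k that starts last: if its length is positive, all other
-- jobs end by s k.
sumFin-lengths≤ : {n : ℕ} (s l : Fin n → ℚ) {B : ℚ} → 0ℚ ≤ B → (∀ i → 0ℚ ≤ s i) →
  (∀ i → s i + l i ≤ B) → NonOverlapping s l → sumFin l ≤ B
sumFin-lengths≤ {zero}  s l 0≤B 0≤s ends≤B disjoint = 0≤B
sumFin-lengths≤ {suc n} s l {B} 0≤B 0≤s ends≤B disjoint = begin
  sumFin l                     ≡⟨ sumFin-removeAt l k ⟩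
  l k + sumFin (removeAt l k)  ≤⟨ split (l k ≤? 0ℚ) ⟩
  B                            ∎
  where
  k : Fin (suc n)
  k = proj₁ (argmax s)
  s≤sk : ∀ i → s i ≤ s k
  s≤sk = proj₂ (argmax s)

  others≤ : ∀ {b} → 0ℚ ≤ b → (∀ i → s (punchIn k i) + l (punchIn k i) ≤ b) →
    sumFin (removeAt l k) ≤ b
  others≤ 0≤b ends≤b = sumFin-lengths≤ (removeAt s k) (removeAt l k) 0≤b
    (0≤s ∘ punchIn k) ends≤b (nonOverlapping-removeAt disjoint k)

  others-end-by-sk : 0ℚ < l k → ∀ i → s (punchIn k i) + l (punchIn k i) ≤ s k
  others-end-by-sk 0<lk i with disjoint (punchIn k i) k (punchInᵢ≢i k i)
  ... | inj₁ i-first = i-first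
  ... | inj₂ k-first = ⊥-elim (<-irrefl refl (begin-strict
    s k                ≡⟨ +-identityʳ (s k) ⟨
    s k + 0ℚ           <⟨ +-monoʳ-< (s k) 0<lk ⟩
    s k + l k          ≤⟨ k-first ⟩
    s (punchIn k i)    ≤⟨ s≤sk (punchIn k i) ⟩
    s k                ∎))

  split : Dec (l k ≤ 0ℚ) → l k + sumFin (removeAt l k) ≤ B
  split (yes lk≤0) = begin
    l k + sumFin (removeAt l k)  ≤⟨ +-mono-≤ lk≤0 (others≤ 0≤B (ends≤B ∘ punchIn k)) ⟩
    0ℚ + B                       ≡⟨ +-identityˡ B ⟩
    B                            ∎
  split (no lk≰0) = begin
    l k + sumFin (removeAt l k)  ≤⟨ +-monoʳ-≤ (l k) (others≤ (0≤s k) (others-end-by-sk (≰⇒> lk≰0))) ⟩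
    l k + s k                    ≡⟨ +-comm (l k) (s k) ⟩
    s k + l k                    ≤⟨ ends≤B k ⟩
    B                            ∎

processing : (β : ℚ) {n : ℕ} (α s : Fin n → ℚ) → Fin n → ℚ
processing β α s i = β * s i + α i

completion≡start+processing : (β : ℚ) {n : ℕ} (α s : Fin n → ℚ) (i : Fin n) →
  completion β α s i ≡ s i + processing β α s i
completion≡start+processing β α s i =
  solve 3 (λ b t a → (con 1ℚ :+ b) :* t :+ a := t :+ (b :* t :+ a)) refl β (s i) (α i)

feasible⇒nonOverlapping : (β : ℚ) {n : ℕ} {r : Fin n → ℚ} (α s : Fin n → ℚ) →
  Feasible β r α s → NonOverlapping s (processing β α s)
feasible⇒nonOverlapping β α s (_ , disjoint) i j i≢j =
  Sum.map (subst (_≤ s j) (completion≡start+processing β α s i))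
          (subst (_≤ s i) (completion≡start+processing β α s j))
          (disjoint i j i≢j)

completion-nonNeg : (β : ℚ) {n : ℕ} (α s : Fin n → ℚ) → 0ℚ ≤ β →
  (∀ i → 0ℚ ≤ α i) → (∀ i → 0ℚ ≤ s i) → ∀ i → 0ℚ ≤ completion β α s i
completion-nonNeg β α s 0≤β 0≤α 0≤s i =
  nonNegative⁻¹ _ {{nonNeg+nonNeg⇒nonNeg ((1ℚ + β) * s i) (α i)}}
  where instance
    _ = nonNegative 0≤β
    _ = nonNegative (0≤α i)
    _ = nonNegative (0≤s i)
    _ = nonNeg+nonNeg⇒nonNeg 1ℚ β
    _ = nonNeg*nonNeg⇒nonNeg (1ℚ + β) (s i)

feasible⇒0≤start : (β : ℚ) {n : ℕ} {r : Fin n → ℚ} (α s : Fin n → ℚ) →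
  (∀ i → 0ℚ ≤ r i) → Feasible β r α s → ∀ i → 0ℚ ≤ s i
feasible⇒0≤start β α s 0≤r (r≤s , _) i = ≤-trans (0≤r i) (r≤s i)

makespan≤totalCompletion : (β : ℚ) {n : ℕ} (α s : Fin n → ℚ) → 0ℚ ≤ β →
  (∀ i → 0ℚ ≤ α i) → (∀ i → 0ℚ ≤ s i) → makespan β α s ≤ totalCompletion β α s
makespan≤totalCompletion β α s 0≤β 0≤α 0≤s =
  maxFin≤sumFin (completion-nonNeg β α s 0≤β 0≤α 0≤s)

module _ (β : ℚ) (βpos : 0ℚ < β) where

  private
    β⁻¹ : ℚ
    β⁻¹ = (1/ β) {{>-nonZero βpos}}

    0≤β⁻¹ : 0ℚ ≤ β⁻¹
    0≤β⁻¹ = <⇒≤ (positive⁻¹ β⁻¹ {{1/pos⇒pos β {{positive βpos}}}})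

  0≤1+β⁻¹ : 0ℚ ≤ 1ℚ + β⁻¹
  0≤1+β⁻¹ = +-mono-≤ (<⇒≤ (positive⁻¹ 1ℚ)) 0≤β⁻¹

  -- Since β s i ≤ processing time, the start s i is at most (1/β) times it.
  completion≤[1+1/β]*processing : {n : ℕ} (α s : Fin n → ℚ) (i : Fin n) → 0ℚ ≤ α i →
    completion β α s i ≤ (1ℚ + β⁻¹) * processing β α s i
  completion≤[1+1/β]*processing α s i 0≤αi = begin
    completion β α s i        ≡⟨ completion≡start+processing β α s i ⟩
    s i + p                   ≤⟨ p≤p+q (s i + p) (nonNegative⁻¹ _ {{nonNeg*nonNeg⇒nonNeg β⁻¹ (α i)}}) ⟩
    s i + p + β⁻¹ * α i       ≡⟨ cong (λ t → t + p + β⁻¹ * α i) (*-identityˡ (s i)) ⟨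
    1ℚ * s i + p + β⁻¹ * α i  ≡⟨ cong (λ t → t * s i + p + β⁻¹ * α i) (*-inverseˡ β {{>-nonZero βpos}}) ⟨
    (β⁻¹ * β) * s i + p + β⁻¹ * α i
      ≡⟨ solve 4 (λ y b t a → ((y :* b) :* t :+ (b :* t :+ a)) :+ y :* a
                              := (con 1ℚ :+ y) :* (b :* t :+ a)) refl β⁻¹ β (s i) (α i) ⟩
    (1ℚ + β⁻¹) * p            ∎
    where
    p : ℚ
    p = processing β α s i
    instance
      _ = nonNegative 0≤β⁻¹
      _ = nonNegative 0≤αi

  totalCompletion≤[1+1/β]*makespan : {n : ℕ} (r α s : Fin n → ℚ) →
    (∀ i → 0ℚ ≤ r i) → (∀ i → 0ℚ ≤ α i) → Feasible β r α s →
    totalCompletion β α s ≤ (1ℚ + β⁻¹) * makespan β α s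
  totalCompletion≤[1+1/β]*makespan r α s 0≤r 0≤α feasible = begin
    sumFin C
      ≤⟨ sumFin-mono-≤ (λ i → completion≤[1+1/β]*processing α s i (0≤α i)) ⟩
    sumFin (λ i → (1ℚ + β⁻¹) * p i)
      ≡⟨ *-distribˡ-sumFin (1ℚ + β⁻¹) p ⟨
    (1ℚ + β⁻¹) * sumFin p
      ≤⟨ *-monoˡ-≤-nonNeg (1ℚ + β⁻¹) {{nonNegative 0≤1+β⁻¹}} busy≤makespan ⟩
    (1ℚ + β⁻¹) * maxFin C   ∎
    where
    C p : Fin _ → ℚ
    C = completion β α s
    p = processing β α s
    busy≤makespan : sumFin p ≤ maxFin C
    busy≤makespan = sumFin-lengths≤ s p (maxFin-nonNeg C) (feasible⇒0≤start β α s 0≤r feasible)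
      (λ i → subst (_≤ maxFin C) (completion≡start+processing β α s i) (f≤maxFin C i))
      (feasible⇒nonOverlapping β α s feasible)

-- Witnessed by one job with r = 0 and α = 1, whose makespan is positive.
makespan-approx⇒0≤ρ : {β ρ : ℚ} {A : Algorithm} → ApproxFor makespan β ρ A → 0ℚ ≤ ρ
makespan-approx⇒0≤ρ {β} {ρ} {A} approx = *-cancelʳ-≤-pos M {{positive 0<M}} (begin
  0ℚ * M                                   ≡⟨ *-zeroˡ M ⟩
  0ℚ                                       ≤⟨ maxFin-nonNeg (completion β α (A 1 r α)) ⟩
  makespan β α (A 1 r α)                   ≤⟨ proj₂ (approx 1 r α (λ _ → ≤-refl) 0≤α) r feasible ⟩
  ρ * M                                    ∎)
  where
  r α : Fin 1 → ℚ
  r _ = 0ℚ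
  α _ = 1ℚ
  0≤α : ∀ i → 0ℚ ≤ α i
  0≤α _ = <⇒≤ (positive⁻¹ 1ℚ)
  M : ℚ
  M = makespan β α r
  feasible : Feasible β r α r
  feasible = (λ _ → ≤-refl) , λ { zero zero 0≢0 → ⊥-elim (0≢0 refl) }
  0<M : 0ℚ < M
  0<M = begin-strict
    0ℚ                      <⟨ positive⁻¹ 1ℚ ⟩
    1ℚ                      ≡⟨ +-identityˡ 1ℚ ⟨
    0ℚ + 1ℚ                 ≡⟨ cong (_+ 1ℚ) (*-zeroʳ (1ℚ + β)) ⟨
    completion β α r zero   ≤⟨ f≤maxFin (completion β α r) zero ⟩
    M                       ∎

theorem17 : (β ρ : ℚ) (βpos : 0ℚ < β) (A : Algorithm) →
    ApproxFor makespan β ρ A →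
    ApproxFor totalCompletion β ((1ℚ + (1/ β) {{>-nonZero βpos}}) * ρ) A
theorem17 β ρ βpos A approx n r α 0≤r 0≤α = feasibleA , bound
  where
  β⁻¹ : ℚ
  β⁻¹ = (1/ β) {{>-nonZero βpos}}
  sA : Fin n → ℚ
  sA = A n r α
  feasibleA : Feasible β r α sA
  feasibleA = proj₁ (approx n r α 0≤r 0≤α)
  bound : (s : Fin n → ℚ) → Feasible β r α s →
    totalCompletion β α sA ≤ ((1ℚ + β⁻¹) * ρ) * totalCompletion β α s
  bound s feasible = begin
    totalCompletion β α sA
      ≤⟨ totalCompletion≤[1+1/β]*makespan β βpos r α sA 0≤r 0≤α feasibleA ⟩
    (1ℚ + β⁻¹) * makespan β α sA
      ≤⟨ *-monoˡ-≤-nonNeg (1ℚ + β⁻¹) (proj₂ (approx n r α 0≤r 0≤α) s feasible) ⟩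
    (1ℚ + β⁻¹) * (ρ * makespan β α s)
      ≤⟨ *-monoˡ-≤-nonNeg (1ℚ + β⁻¹) (*-monoˡ-≤-nonNeg ρ makespan≤total) ⟩
    (1ℚ + β⁻¹) * (ρ * totalCompletion β α s)
      ≡⟨ *-assoc (1ℚ + β⁻¹) ρ _ ⟨
    ((1ℚ + β⁻¹) * ρ) * totalCompletion β α s   ∎
    where
    makespan≤total : makespan β α s ≤ totalCompletion β α s
    makespan≤total = makespan≤totalCompletion β α s (<⇒≤ βpos) 0≤α
      (feasible⇒0≤start β α s 0≤r feasible)
    instance
      _ = nonNegative (0≤1+β⁻¹ β βpos)
      _ = nonNegative (makespan-approx⇒0≤ρ {β} {ρ} approx)
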